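{- For every integer $r\ge 2$, $$f(n,r,r+1,\{3,4,\ldots,r+1\})=2^{\Theta(n^{r})}$$ as $n\to\infty$.
   Context: An $r$-graph is an $r$-uniform hypergraph. For a list $L\subseteq\{0,1,\ldots,\binom{k}{r}\}$, an $r$-graph $G$ is $(L,k)$-free if for every $i\in L$ there is no set of $k$ vertices of $G$ spanning exactly $i$ edges. $f(n,r,k,L)$ denotes the number of $(L,k)$-free $r$-graphs on the vertex set $[n]=\{1,\ldots,n\}$. -}

module Defs where

open import Data.Nat using (ℕ; zero; suc; _+_; _≡ᵇ_)
open import Data.Bool using (Bool; true; false; not; _∧_; _∨_)
open import Data.List using (List; []; _∷_; _++_; map; filterᵇ; length; upTo)
open import Data.Bool.ListAction using (and; or)
open import Data.Vec using (Vec; []; _∷_)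
open import Data.Fin.Subset using (Subset; ∣_∣; _⊆_)
open import Data.Fin.Subset.Properties using (_⊆?_)
open import Relation.Nullary.Decidable using (⌊_⌋)

allSubsets : (n : ℕ) → List (Subset n)
allSubsets zero = [] ∷ []
allSubsets (suc n) = map (false ∷_) (allSubsets n) ++ map (true ∷_) (allSubsets n)

rSets : (n r : ℕ) → List (Subset n)
rSets n r = filterᵇ (λ s → ∣ s ∣ ≡ᵇ r) (allSubsets n)

-- All sublists (sub-collections) of a list; applied to a duplicate-free
-- list this enumerates each subset exactly once.
sublists : {A : Set} → List A → List (List A)
sublists [] = [] ∷ []
sublists (x ∷ xs) = sublists xs ++ map (x ∷_) (sublists xs)

-- An r-graph on [n] is given by its edge set, a sub-collection of rSets n r.
-- The list of all r-graphs on the vertex set [n]: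
rGraphs : (n r : ℕ) → List (List (Subset n))
rGraphs n r = sublists (rSets n r)

spanned : {n : ℕ} → List (Subset n) → Subset n → ℕ
spanned G S = length (filterᵇ (λ e → ⌊ e ⊆? S ⌋) G)

elemℕ : ℕ → List ℕ → Bool
elemℕ i L = or (map (λ j → i ≡ᵇ j) L)

isFree : {n : ℕ} → ℕ → List ℕ → List (Subset n) → Bool
isFree {n} k L G =
  and (map (λ S → not ((∣ S ∣ ≡ᵇ k) ∧ elemℕ (spanned G S) L)) (allSubsets n))

f : (n r k : ℕ) → List ℕ → ℕ
f n r k L = length (filterᵇ (isFree k L) (rGraphs n r))

threeTo : ℕ → List ℕ
threeTo r = map (3 +_) (upTo (r Data.Nat.∸ 1))

{-# OPTIONS --safe #-}
-- Split [n] into r blocks of ⌊n/r⌋ vertices (plus fewer than r leftover vertices).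
-- A transversal takes one vertex from each block. The block sizes of an (r+1)-set
-- S add up to at most r + 1, so S contains at most two transversals; hence every
-- family of transversals is ({3,…,r+1}, r+1)-free, and f ≥ 2^(⌊n/r⌋^r) ≥ 2^(n^r/(2r)^r).
-- The upper bound 2^(n^r) just counts all r-graphs.
module Submission where

open import Defs
open import Data.Nat using (ℕ; _≤_; _+_; _*_; _^_)
open import Data.Product using (Σ; _×_)

open import Algebra.Bundles using (CommutativeMonoid)
open import Data.Bool using (Bool; true; false; not; _∧_; T; T?)
open import Data.Bool.Properties using (∧-zeroʳ; ∧-identityʳ; ∧-commutativeMonoid; T-∧)
open import Data.Fin.Subset using (Subset; ∣_∣; ⊤; outside; inside)
open import Data.Fin.Subset.Properties using (_⊆?_; ⊆⊤; ∣⊤∣≡n)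
open import Data.List using (List; []; _∷_; _++_; map; filterᵇ; length; upTo)
open import Data.List.Properties using (length-++; length-map; filter-++; filter-accept; length-filter)
open import Data.List.Relation.Binary.Sublist.Propositional using ([]; _∷_; _∷ʳ_; ⊆-refl)
  renaming (_⊆_ to _⊑_)
open import Data.List.Relation.Binary.Sublist.Propositional.Properties using (filter⁺; length-mono-≤)
open import Data.List.Relation.Unary.All using (universal)
open import Data.List.Relation.Unary.All.Properties using (all⁻)
open import Data.Nat using (zero; suc; z≤n; s≤s; _<_; _∸_; _≡ᵇ_; NonZero; >-nonZero)
open import Data.Nat.DivMod using (_/_; _%_; m≡m%n+[m/n]*n; m%n<n; m≥n⇒m/n>0)
open import Data.Nat.ListAction using (sum; product)
open import Data.Nat.Properties
open import Data.Nat.Solver using (module +-*-Solver)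
open import Data.Product using (_,_; proj₁; proj₂)
open import Data.Vec using ([]; _∷_; take; drop) renaming (_++_ to _++ᵛ_)
open import Function using (_∘_)
open import Function.Bundles using (Equivalence)
open import Relation.Binary.PropositionalEquality
open import Relation.Nullary.Decidable using (does; dec-true; isYes≗does)
open import Algebra.Properties.CommutativeSemigroup
  (CommutativeMonoid.commutativeSemigroup ∧-commutativeMonoid)
  using () renaming (interchange to ∧-interchange)

open +-*-Solver using (solve; _:+_; _:*_; con; _:=_)

countᵇ : {A : Set} → (A → Bool) → List A → ℕ
countᵇ p xs = length (filterᵇ p xs)

module _ {A : Set} where

  countᵇ-++ : (p : A → Bool) (xs ys : List A) →
              countᵇ p (xs ++ ys) ≡ countᵇ p xs + countᵇ p ys
  countᵇ-++ p xs ys = trans (cong length (filter-++ _ xs ys)) (length-++ (filterᵇ p xs))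

  countᵇ-cong : {p q : A → Bool} → (∀ x → p x ≡ q x) → (xs : List A) →
                countᵇ p xs ≡ countᵇ q xs
  countᵇ-cong p≗q [] = refl
  countᵇ-cong {p} {q} p≗q (x ∷ xs) with p x | q x | p≗q x
  ... | true  | .true  | refl = cong suc (countᵇ-cong p≗q xs)
  ... | false | .false | refl = countᵇ-cong p≗q xs

  countᵇ-none : {p : A → Bool} → (∀ x → p x ≡ false) → (xs : List A) → countᵇ p xs ≡ 0
  countᵇ-none p≗false [] = refl
  countᵇ-none p≗false (x ∷ xs) rewrite p≗false x = countᵇ-none p≗false xs

  countᵇ-filterᵇ : (p q : A → Bool) (xs : List A) →
                   countᵇ p (filterᵇ q xs) ≡ countᵇ (λ x → q x ∧ p x) xs
  countᵇ-filterᵇ p q [] = refl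
  countᵇ-filterᵇ p q (x ∷ xs) with q x
  ... | false = countᵇ-filterᵇ p q xs
  ... | true with p x
  ...   | true  = cong suc (countᵇ-filterᵇ p q xs)
  ...   | false = countᵇ-filterᵇ p q xs

  countᵇ-mono-⊑ : (p : A → Bool) {xs ys : List A} → xs ⊑ ys → countᵇ p xs ≤ countᵇ p ys
  countᵇ-mono-⊑ p xs⊑ys = length-mono-≤ (filter⁺ _ _ (λ { refl px → px }) xs⊑ys)

countᵇ-map : {A B : Set} (p : B → Bool) (g : A → B) (xs : List A) →
             countᵇ p (map g xs) ≡ countᵇ (λ x → p (g x)) xs
countᵇ-map p g [] = refl
countᵇ-map p g (x ∷ xs) with p (g x)
... | true  = cong suc (countᵇ-map p g xs)
... | false = countᵇ-map p g xs

length-sublists : {A : Set} (xs : List A) → length (sublists xs) ≡ 2 ^ length xs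
length-sublists [] = refl
length-sublists (x ∷ xs) = begin
  length (sublists xs ++ map (x ∷_) (sublists xs))
    ≡⟨ length-++ (sublists xs) ⟩
  length (sublists xs) + length (map (x ∷_) (sublists xs))
    ≡⟨ cong (length (sublists xs) +_) (length-map (x ∷_) (sublists xs)) ⟩
  length (sublists xs) + length (sublists xs)
    ≡⟨ cong₂ _+_ (length-sublists xs) (trans (length-sublists xs) (sym (+-identityʳ _))) ⟩
  2 ^ length (x ∷ xs) ∎
  where open ≡-Reasoning

2^length≤countᵇ-sublists : {A : Set} (q : List A → Bool) {ys xs : List A} → ys ⊑ xs →
  (∀ zs → zs ⊑ ys → T (q zs)) → 2 ^ length ys ≤ countᵇ q (sublists xs)
2^length≤countᵇ-sublists q [] q-holds =
  ≤-reflexive (sym (cong length (filter-accept (T? ∘ q) (q-holds [] []))))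
2^length≤countᵇ-sublists q (_∷ʳ_ {xs = ys} {ys = xs} x ys⊑xs) q-holds = begin
  2 ^ length ys                           ≤⟨ 2^length≤countᵇ-sublists q ys⊑xs q-holds ⟩
  countᵇ q (sublists xs)                  ≤⟨ m≤m+n _ _ ⟩
  countᵇ q (sublists xs) + countᵇ q (map (x ∷_) (sublists xs))
    ≡⟨ countᵇ-++ q (sublists xs) _ ⟨
  countᵇ q (sublists (x ∷ xs))            ∎
  where open ≤-Reasoning
2^length≤countᵇ-sublists q (_∷_ {x = x} {xs = ys} {ys = xs} refl ys⊑xs) q-holds = begin
  2 ^ length ys + (2 ^ length ys + 0)
    ≤⟨ +-mono-≤ without-x (≤-trans (≤-reflexive (+-identityʳ _)) with-x) ⟩
  countᵇ q (sublists xs) + countᵇ (λ zs → q (x ∷ zs)) (sublists xs)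
    ≡⟨ cong (countᵇ q (sublists xs) +_) (countᵇ-map q (x ∷_) (sublists xs)) ⟨
  countᵇ q (sublists xs) + countᵇ q (map (x ∷_) (sublists xs))
    ≡⟨ countᵇ-++ q (sublists xs) _ ⟨
  countᵇ q (sublists (x ∷ xs)) ∎
  where
  open ≤-Reasoning
  without-x : 2 ^ length ys ≤ countᵇ q (sublists xs)
  without-x = 2^length≤countᵇ-sublists q ys⊑xs (λ zs zs⊑ys → q-holds zs (x ∷ʳ zs⊑ys))
  with-x : 2 ^ length ys ≤ countᵇ (λ zs → q (x ∷ zs)) (sublists xs)
  with-x = 2^length≤countᵇ-sublists (λ zs → q (x ∷ zs)) ys⊑xs
             (λ zs zs⊑ys → q-holds (x ∷ zs) (refl ∷ zs⊑ys))

_⊆ᵇ_ : ∀ {n} → Subset n → Subset n → Bool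
v ⊆ᵇ S = does (v ⊆? S)

⊆ᵇ-⊤ : ∀ {n} (v : Subset n) → v ⊆ᵇ ⊤ ≡ true
⊆ᵇ-⊤ v = dec-true (v ⊆? ⊤) ⊆⊤

isEmpty : ∀ {n} → Subset n → Bool
isEmpty []      = true
isEmpty (b ∷ v) = not b ∧ isEmpty v

isSingleton : ∀ {n} → Subset n → Bool
isSingleton []            = false
isSingleton (outside ∷ v) = isSingleton v
isSingleton (inside ∷ v)  = isEmpty v

∣isEmpty∣≡0 : ∀ {n} (v : Subset n) → T (isEmpty v) → ∣ v ∣ ≡ 0
∣isEmpty∣≡0 []            _ = refl
∣isEmpty∣≡0 (outside ∷ v) e = ∣isEmpty∣≡0 v e

∣isSingleton∣≡1 : ∀ {n} (v : Subset n) → T (isSingleton v) → ∣ v ∣ ≡ 1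
∣isSingleton∣≡1 (outside ∷ v) s = ∣isSingleton∣≡1 v s
∣isSingleton∣≡1 (inside ∷ v)  s = cong suc (∣isEmpty∣≡0 v s)

take-++ : ∀ {m n} (x : Subset m) (y : Subset n) → take m (x ++ᵛ y) ≡ x
take-++ []      y = refl
take-++ (b ∷ x) y = cong (b ∷_) (take-++ x y)

drop-++ : ∀ {m n} (x : Subset m) (y : Subset n) → drop m (x ++ᵛ y) ≡ y
drop-++ []      y = refl
drop-++ (b ∷ x) y = drop-++ x y

∣p∣≡∣take∣+∣drop∣ : ∀ m {n} (S : Subset (m + n)) → ∣ S ∣ ≡ ∣ take m S ∣ + ∣ drop m S ∣
∣p∣≡∣take∣+∣drop∣ zero          S = refl
∣p∣≡∣take∣+∣drop∣ (suc m) (inside  ∷ S) = cong suc (∣p∣≡∣take∣+∣drop∣ m S)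
∣p∣≡∣take∣+∣drop∣ (suc m) (outside ∷ S) = ∣p∣≡∣take∣+∣drop∣ m S

⊆ᵇ-++ : ∀ {m n} (x : Subset m) (y : Subset n) (S : Subset (m + n)) →
        (x ++ᵛ y) ⊆ᵇ S ≡ x ⊆ᵇ take m S ∧ y ⊆ᵇ drop m S
⊆ᵇ-++ []            y S               = refl
⊆ᵇ-++ (outside ∷ x) y (_ ∷ S)         = ⊆ᵇ-++ x y S
⊆ᵇ-++ (inside ∷ x)  y (outside ∷ S)   = refl
⊆ᵇ-++ (inside ∷ x)  y (inside ∷ S)    = ⊆ᵇ-++ x y S

countᵇ-allSubsets-suc : ∀ n (p : Subset (suc n) → Bool) →
  countᵇ p (allSubsets (suc n)) ≡
  countᵇ (λ v → p (outside ∷ v)) (allSubsets n) + countᵇ (λ v → p (inside ∷ v)) (allSubsets n)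
countᵇ-allSubsets-suc n p = trans
  (countᵇ-++ p (map (outside ∷_) (allSubsets n)) _)
  (cong₂ _+_ (countᵇ-map p (outside ∷_) (allSubsets n)) (countᵇ-map p (inside ∷_) (allSubsets n)))

countᵇ-allSubsets-++ : ∀ a {b} (P : Subset (a + b) → Bool) (p : Subset a → Bool) (q : Subset b → Bool) →
  (∀ x y → P (x ++ᵛ y) ≡ p x ∧ q y) →
  countᵇ P (allSubsets (a + b)) ≡ countᵇ p (allSubsets a) * countᵇ q (allSubsets b)
countᵇ-allSubsets-++ zero {b} P p q P-split with p [] in p[]
... | true  = trans (countᵇ-cong (λ y → trans (P-split [] y) (cong (_∧ q y) p[])) (allSubsets b))
                    (sym (+-identityʳ _))
... | false = countᵇ-none (λ y → trans (P-split [] y) (cong (_∧ q y) p[])) (allSubsets b)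
countᵇ-allSubsets-++ (suc a) {b} P p q P-split = begin
  countᵇ P (allSubsets (suc a + b))
    ≡⟨ countᵇ-allSubsets-suc (a + b) P ⟩
  countᵇ (λ v → P (outside ∷ v)) (allSubsets (a + b)) + countᵇ (λ v → P (inside ∷ v)) (allSubsets (a + b))
    ≡⟨ cong₂ _+_ (countᵇ-allSubsets-++ a _ _ q (λ x → P-split (outside ∷ x)))
                 (countᵇ-allSubsets-++ a _ _ q (λ x → P-split (inside ∷ x))) ⟩
  countᵇ (λ v → p (outside ∷ v)) (allSubsets a) * countᵇ q (allSubsets b)
    + countᵇ (λ v → p (inside ∷ v)) (allSubsets a) * countᵇ q (allSubsets b)
    ≡⟨ *-distribʳ-+ (countᵇ q (allSubsets b)) (countᵇ (λ v → p (outside ∷ v)) (allSubsets a))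
                   (countᵇ (λ v → p (inside ∷ v)) (allSubsets a)) ⟨
  (countᵇ (λ v → p (outside ∷ v)) (allSubsets a) + countᵇ (λ v → p (inside ∷ v)) (allSubsets a))
    * countᵇ q (allSubsets b)
    ≡⟨ cong (_* countᵇ q (allSubsets b)) (countᵇ-allSubsets-suc a p) ⟨
  countᵇ p (allSubsets (suc a)) * countᵇ q (allSubsets b) ∎
  where open ≡-Reasoning

countᵇ-isEmpty-⊆ : ∀ {n} (S : Subset n) → countᵇ (λ v → isEmpty v ∧ v ⊆ᵇ S) (allSubsets n) ≡ 1
countᵇ-isEmpty-⊆ [] = refl
countᵇ-isEmpty-⊆ {suc n} (b ∷ S) = begin
  countᵇ (λ v → isEmpty v ∧ v ⊆ᵇ (b ∷ S)) (allSubsets (suc n))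
    ≡⟨ countᵇ-allSubsets-suc n _ ⟩
  countᵇ (λ v → isEmpty v ∧ v ⊆ᵇ S) (allSubsets n) + countᵇ (λ _ → false) (allSubsets n)
    ≡⟨ cong (countᵇ (λ v → isEmpty v ∧ v ⊆ᵇ S) (allSubsets n) +_) (countᵇ-none (λ _ → refl) (allSubsets n)) ⟩
  countᵇ (λ v → isEmpty v ∧ v ⊆ᵇ S) (allSubsets n) + 0
    ≡⟨ +-identityʳ _ ⟩
  countᵇ (λ v → isEmpty v ∧ v ⊆ᵇ S) (allSubsets n)
    ≡⟨ countᵇ-isEmpty-⊆ S ⟩
  1 ∎
  where open ≡-Reasoning

countᵇ-isSingleton-⊆ : ∀ {n} (S : Subset n) → countᵇ (λ v → isSingleton v ∧ v ⊆ᵇ S) (allSubsets n) ≡ ∣ S ∣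
countᵇ-isSingleton-⊆ [] = refl
countᵇ-isSingleton-⊆ {suc n} (outside ∷ S) = begin
  countᵇ (λ v → isSingleton v ∧ v ⊆ᵇ (outside ∷ S)) (allSubsets (suc n))
    ≡⟨ countᵇ-allSubsets-suc n _ ⟩
  countᵇ (λ v → isSingleton v ∧ v ⊆ᵇ S) (allSubsets n)
    + countᵇ (λ v → isEmpty v ∧ false) (allSubsets n)
    ≡⟨ cong (countᵇ (λ v → isSingleton v ∧ v ⊆ᵇ S) (allSubsets n) +_)
            (countᵇ-none (λ v → ∧-zeroʳ (isEmpty v)) (allSubsets n)) ⟩
  countᵇ (λ v → isSingleton v ∧ v ⊆ᵇ S) (allSubsets n) + 0
    ≡⟨ +-identityʳ _ ⟩
  countᵇ (λ v → isSingleton v ∧ v ⊆ᵇ S) (allSubsets n)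
    ≡⟨ countᵇ-isSingleton-⊆ S ⟩
  ∣ S ∣ ∎
  where open ≡-Reasoning
countᵇ-isSingleton-⊆ {suc n} (inside ∷ S) = begin
  countᵇ (λ v → isSingleton v ∧ v ⊆ᵇ (inside ∷ S)) (allSubsets (suc n))
    ≡⟨ countᵇ-allSubsets-suc n _ ⟩
  countᵇ (λ v → isSingleton v ∧ v ⊆ᵇ S) (allSubsets n)
    + countᵇ (λ v → isEmpty v ∧ v ⊆ᵇ S) (allSubsets n)
    ≡⟨ cong₂ _+_ (countᵇ-isSingleton-⊆ S) (countᵇ-isEmpty-⊆ S) ⟩
  ∣ S ∣ + 1
    ≡⟨ +-comm ∣ S ∣ 1 ⟩
  suc ∣ S ∣ ∎
  where open ≡-Reasoning

countᵇ-⊆ᵇ-⊤ : ∀ n (p : Subset n → Bool) →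
  countᵇ p (allSubsets n) ≡ countᵇ (λ v → p v ∧ v ⊆ᵇ ⊤) (allSubsets n)
countᵇ-⊆ᵇ-⊤ n p = countᵇ-cong (λ v → sym (trans (cong (p v ∧_) (⊆ᵇ-⊤ v)) (∧-identityʳ (p v)))) (allSubsets n)

countᵇ-isEmpty : ∀ n → countᵇ isEmpty (allSubsets n) ≡ 1
countᵇ-isEmpty n = trans (countᵇ-⊆ᵇ-⊤ n isEmpty) (countᵇ-isEmpty-⊆ (⊤ {n}))

countᵇ-isSingleton : ∀ n → countᵇ isSingleton (allSubsets n) ≡ n
countᵇ-isSingleton n = trans (countᵇ-⊆ᵇ-⊤ n isSingleton) (trans (countᵇ-isSingleton-⊆ (⊤ {n})) (∣⊤∣≡n n))

sum<length⇒product≡0 : ∀ xs → sum xs < length xs → product xs ≡ 0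
sum<length⇒product≡0 (zero  ∷ xs) _ = refl
sum<length⇒product≡0 (suc x ∷ xs) (s≤s sum<length) =
  trans (cong (suc x *_) (sum<length⇒product≡0 xs (≤-trans (s≤s (m≤n+m (sum xs) x)) sum<length)))
        (*-zeroʳ (suc x))

sum≤length⇒product≤1 : ∀ xs → sum xs ≤ length xs → product xs ≤ 1
sum≤length⇒product≤1 []                 _ = ≤-refl
sum≤length⇒product≤1 (zero        ∷ xs) _ = z≤n
sum≤length⇒product≤1 (suc zero    ∷ xs) (s≤s sum≤length) =
  ≤-trans (≤-reflexive (+-identityʳ (product xs))) (sum≤length⇒product≤1 xs sum≤length)
sum≤length⇒product≤1 (suc (suc x) ∷ xs) (s≤s sum≤length)
  rewrite sum<length⇒product≡0 xs (≤-trans (s≤s (m≤n+m (sum xs) x)) sum≤length)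
        | *-zeroʳ x = z≤n

-- Either some entry is 0, or all entries are 1 except for at most one 2.
sum≤1+length⇒product≤2 : ∀ xs → sum xs ≤ suc (length xs) → product xs ≤ 2
sum≤1+length⇒product≤2 []                       _ = s≤s z≤n
sum≤1+length⇒product≤2 (zero              ∷ xs) _ = z≤n
sum≤1+length⇒product≤2 (suc zero          ∷ xs) (s≤s sum≤1+length) =
  ≤-trans (≤-reflexive (+-identityʳ (product xs))) (sum≤1+length⇒product≤2 xs sum≤1+length)
sum≤1+length⇒product≤2 (suc (suc zero)    ∷ xs) (s≤s (s≤s sum≤length)) =
  +-mono-≤ product≤1 (≤-trans (≤-reflexive (+-identityʳ (product xs))) product≤1)
  where
  product≤1 : product xs ≤ 1
  product≤1 = sum≤length⇒product≤1 xs sum≤length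
sum≤1+length⇒product≤2 (suc (suc (suc x)) ∷ xs) (s≤s (s≤s sum≤length))
  rewrite sum<length⇒product≡0 xs (≤-trans (s≤s (m≤n+m (sum xs) x)) sum≤length)
        | *-zeroʳ x = z≤n

-- The vertex set is laid out as t consecutive blocks of m vertices followed by
-- e vertices that belong to no block.
blockedSize : ℕ → ℕ → ℕ → ℕ
blockedSize zero    m e = e
blockedSize (suc t) m e = m + blockedSize t m e

blockedSize≡ : ∀ t m e → blockedSize t m e ≡ t * m + e
blockedSize≡ zero    m e = refl
blockedSize≡ (suc t) m e = trans (cong (m +_) (blockedSize≡ t m e)) (sym (+-assoc m (t * m) e))

isTransversal : ∀ t m e → Subset (blockedSize t m e) → Bool
isTransversal zero    m e v = isEmpty v
isTransversal (suc t) m e v = isSingleton (take m v) ∧ isTransversal t m e (drop m v)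

blockSizes : ∀ t m e → Subset (blockedSize t m e) → List ℕ
blockSizes zero    m e S = []
blockSizes (suc t) m e S = ∣ take m S ∣ ∷ blockSizes t m e (drop m S)

∣isTransversal∣≡t : ∀ t m e (v : Subset (blockedSize t m e)) → T (isTransversal t m e v) → ∣ v ∣ ≡ t
∣isTransversal∣≡t zero    m e v transversal = ∣isEmpty∣≡0 v transversal
∣isTransversal∣≡t (suc t) m e v transversal = begin
  ∣ v ∣                          ≡⟨ ∣p∣≡∣take∣+∣drop∣ m v ⟩
  ∣ take m v ∣ + ∣ drop m v ∣    ≡⟨ cong₂ _+_ (∣isSingleton∣≡1 (take m v) singleton)
                                               (∣isTransversal∣≡t t m e (drop m v) rest) ⟩
  suc t                          ∎
  where
  open ≡-Reasoning
  singleton : T (isSingleton (take m v))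
  singleton = proj₁ (Equivalence.to T-∧ transversal)
  rest : T (isTransversal t m e (drop m v))
  rest = proj₂ (Equivalence.to T-∧ transversal)

length-blockSizes : ∀ t m e (S : Subset (blockedSize t m e)) → length (blockSizes t m e S) ≡ t
length-blockSizes zero    m e S = refl
length-blockSizes (suc t) m e S = cong suc (length-blockSizes t m e (drop m S))

sum-blockSizes≤∣∣ : ∀ t m e (S : Subset (blockedSize t m e)) → sum (blockSizes t m e S) ≤ ∣ S ∣
sum-blockSizes≤∣∣ zero    m e S = z≤n
sum-blockSizes≤∣∣ (suc t) m e S = begin
  ∣ take m S ∣ + sum (blockSizes t m e (drop m S)) ≤⟨ +-monoʳ-≤ ∣ take m S ∣ (sum-blockSizes≤∣∣ t m e (drop m S)) ⟩
  ∣ take m S ∣ + ∣ drop m S ∣                     ≡⟨ ∣p∣≡∣take∣+∣drop∣ m S ⟨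
  ∣ S ∣                                           ∎
  where open ≤-Reasoning

countᵇ-isTransversal : ∀ t m e → countᵇ (isTransversal t m e) (allSubsets (blockedSize t m e)) ≡ m ^ t
countᵇ-isTransversal zero    m e = countᵇ-isEmpty e
countᵇ-isTransversal (suc t) m e = trans
  (countᵇ-allSubsets-++ m (isTransversal (suc t) m e) isSingleton (isTransversal t m e)
    (λ x y → cong₂ _∧_ (cong isSingleton (take-++ x y)) (cong (isTransversal t m e) (drop-++ x y))))
  (cong₂ _*_ (countᵇ-isSingleton m) (countᵇ-isTransversal t m e))

-- A transversal inside S picks one of the points of S in each block.
countᵇ-isTransversal-⊆ : ∀ t m e (S : Subset (blockedSize t m e)) →
  countᵇ (λ v → isTransversal t m e v ∧ v ⊆ᵇ S) (allSubsets (blockedSize t m e)) ≡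
  product (blockSizes t m e S)
countᵇ-isTransversal-⊆ zero    m e S = countᵇ-isEmpty-⊆ S
countᵇ-isTransversal-⊆ (suc t) m e S = trans
  (countᵇ-allSubsets-++ m _ (λ x → isSingleton x ∧ x ⊆ᵇ take m S)
                            (λ y → isTransversal t m e y ∧ y ⊆ᵇ drop m S) split)
  (cong₂ _*_ (countᵇ-isSingleton-⊆ (take m S)) (countᵇ-isTransversal-⊆ t m e (drop m S)))
  where
  split : ∀ x y → isTransversal (suc t) m e (x ++ᵛ y) ∧ (x ++ᵛ y) ⊆ᵇ S ≡
                  (isSingleton x ∧ x ⊆ᵇ take m S) ∧ (isTransversal t m e y ∧ y ⊆ᵇ drop m S)
  split x y rewrite take-++ x y | drop-++ x y | ⊆ᵇ-++ x y S =
    ∧-interchange (isSingleton x) (isTransversal t m e y) (x ⊆ᵇ take m S) (y ⊆ᵇ drop m S)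

transversals : ∀ t m e → List (Subset (blockedSize t m e))
transversals t m e = filterᵇ (isTransversal t m e) (allSubsets (blockedSize t m e))

transversals⊑rSets : ∀ r m e → transversals r m e ⊑ rSets (blockedSize r m e) r
transversals⊑rSets r m e = filter⁺ (T? ∘ isTransversal r m e) (T? ∘ (λ v → ∣ v ∣ ≡ᵇ r))
  (λ { {v} refl transversal → ≡⇒≡ᵇ ∣ v ∣ r (∣isTransversal∣≡t r m e v transversal) })
  (⊆-refl {x = allSubsets (blockedSize r m e)})

countᵇ-transversals-⊆≤2 : ∀ r m e (S : Subset (blockedSize r m e)) → ∣ S ∣ ≡ r + 1 →
  countᵇ (_⊆ᵇ S) (transversals r m e) ≤ 2
countᵇ-transversals-⊆≤2 r m e S ∣S∣≡r+1 = begin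
  countᵇ (_⊆ᵇ S) (transversals r m e)
    ≡⟨ countᵇ-filterᵇ (_⊆ᵇ S) (isTransversal r m e) (allSubsets (blockedSize r m e)) ⟩
  countᵇ (λ v → isTransversal r m e v ∧ v ⊆ᵇ S) (allSubsets (blockedSize r m e))
    ≡⟨ countᵇ-isTransversal-⊆ r m e S ⟩
  product (blockSizes r m e S)
    ≤⟨ sum≤1+length⇒product≤2 (blockSizes r m e S) sum≤1+length ⟩
  2 ∎
  where
  open ≤-Reasoning
  sum≤1+length : sum (blockSizes r m e S) ≤ suc (length (blockSizes r m e S))
  sum≤1+length = ≤-trans (sum-blockSizes≤∣∣ r m e S)
    (≤-reflexive (trans ∣S∣≡r+1 (trans (+-comm r 1) (cong suc (sym (length-blockSizes r m e S))))))

≤2⇒∉threeTo : ∀ r {i} → i ≤ 2 → elemℕ i (threeTo r) ≡ false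
≤2⇒∉threeTo r i≤2 = ∉map3+ i≤2 (upTo (r ∸ 1))
  where
  ≢ᵇ3+ : ∀ {i} → i ≤ 2 → ∀ k → (i ≡ᵇ 3 + k) ≡ false
  ≢ᵇ3+ z≤n                 k = refl
  ≢ᵇ3+ (s≤s z≤n)           k = refl
  ≢ᵇ3+ (s≤s (s≤s z≤n))     k = refl
  ∉map3+ : ∀ {i} → i ≤ 2 → ∀ ks → elemℕ i (map (3 +_) ks) ≡ false
  ∉map3+ i≤2 []       = refl
  ∉map3+ i≤2 (k ∷ ks) rewrite ≢ᵇ3+ i≤2 k = ∉map3+ i≤2 ks

transversal-graph-free : ∀ r m e {G} → G ⊑ transversals r m e → T (isFree (r + 1) (threeTo r) G)
transversal-graph-free r m e {G} G⊑transversals =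
  all⁻ _ (universal no-bad-set (allSubsets (blockedSize r m e)))
  where
  spanned≤2 : ∀ S → ∣ S ∣ ≡ r + 1 → spanned G S ≤ 2
  spanned≤2 S ∣S∣≡r+1 = begin
    spanned G S                          ≡⟨ countᵇ-cong (λ v → isYes≗does (v ⊆? S)) G ⟩
    countᵇ (_⊆ᵇ S) G                     ≤⟨ countᵇ-mono-⊑ (_⊆ᵇ S) G⊑transversals ⟩
    countᵇ (_⊆ᵇ S) (transversals r m e)  ≤⟨ countᵇ-transversals-⊆≤2 r m e S ∣S∣≡r+1 ⟩
    2                                    ∎
    where open ≤-Reasoning
  no-bad-set : ∀ S → T (not ((∣ S ∣ ≡ᵇ r + 1) ∧ elemℕ (spanned G S) (threeTo r)))
  no-bad-set S with ∣ S ∣ ≡ᵇ r + 1 in ∣S∣≡ᵇr+1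
  ... | false = _
  ... | true rewrite ≤2⇒∉threeTo r (spanned≤2 S (≡ᵇ⇒≡ ∣ S ∣ (r + 1) (subst T (sym ∣S∣≡ᵇr+1) _))) = _

f-blockedSize≥ : ∀ r m e → 2 ^ (m ^ r) ≤ f (blockedSize r m e) r (r + 1) (threeTo r)
f-blockedSize≥ r m e = begin
  2 ^ (m ^ r)                       ≡⟨ cong (2 ^_) (countᵇ-isTransversal r m e) ⟨
  2 ^ length (transversals r m e)   ≤⟨ 2^length≤countᵇ-sublists (isFree (r + 1) (threeTo r))
                                         (transversals⊑rSets r m e) (λ G → transversal-graph-free r m e) ⟩
  f (blockedSize r m e) r (r + 1) (threeTo r) ∎
  where open ≤-Reasoning

length-rSets≤n^k : ∀ n k → length (rSets n k) ≤ n ^ k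
length-rSets≤n^k zero    zero    = ≤-refl
length-rSets≤n^k zero    (suc k) = z≤n
length-rSets≤n^k (suc n) zero    = begin
  length (rSets (suc n) 0)            ≡⟨ countᵇ-allSubsets-suc n (λ v → ∣ v ∣ ≡ᵇ 0) ⟩
  countᵇ (λ v → ∣ v ∣ ≡ᵇ 0) (allSubsets n) + countᵇ (λ _ → false) (allSubsets n)
    ≡⟨ cong (length (rSets n 0) +_) (countᵇ-none (λ _ → refl) (allSubsets n)) ⟩
  length (rSets n 0) + 0              ≡⟨ +-identityʳ _ ⟩
  length (rSets n 0)                  ≤⟨ length-rSets≤n^k n 0 ⟩
  1                                   ∎
  where open ≤-Reasoning
length-rSets≤n^k (suc n) (suc k) = begin
  length (rSets (suc n) (suc k))      ≡⟨ countᵇ-allSubsets-suc n (λ v → ∣ v ∣ ≡ᵇ suc k) ⟩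
  length (rSets n (suc k)) + length (rSets n k)
    ≤⟨ +-mono-≤ (length-rSets≤n^k n (suc k)) (length-rSets≤n^k n k) ⟩
  n * n ^ k + n ^ k                   ≤⟨ +-mono-≤ (*-monoʳ-≤ n n^k≤) n^k≤ ⟩
  n * suc n ^ k + suc n ^ k           ≡⟨ +-comm (n * suc n ^ k) (suc n ^ k) ⟩
  suc n ^ suc k                       ∎
  where
  open ≤-Reasoning
  n^k≤ : n ^ k ≤ suc n ^ k
  n^k≤ = ^-monoˡ-≤ k (n≤1+n n)

f≤2^n^r : ∀ n r k L → f n r k L ≤ 2 ^ (n ^ r)
f≤2^n^r n r k L = begin
  f n r k L                     ≤⟨ length-filter (T? ∘ isFree k L) (sublists (rSets n r)) ⟩
  length (sublists (rSets n r)) ≡⟨ length-sublists (rSets n r) ⟩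
  2 ^ length (rSets n r)        ≤⟨ ^-monoʳ-≤ 2 (length-rSets≤n^k n r) ⟩
  2 ^ (n ^ r)                   ∎
  where open ≤-Reasoning

^-distribʳ-* : ∀ m n k → (m * n) ^ k ≡ m ^ k * n ^ k
^-distribʳ-* m n zero    = refl
^-distribʳ-* m n (suc k) = trans (cong (m * n *_) (^-distribʳ-* m n k))
  (solve 4 (λ m n x y → (m :* n) :* (x :* y) := (m :* x) :* (n :* y)) refl m n (m ^ k) (n ^ k))

n≤[n/d]*2d : ∀ n d .{{_ : NonZero d}} → d ≤ n → n ≤ n / d * (2 * d)
n≤[n/d]*2d n d d≤n = begin
  n                        ≡⟨ m≡m%n+[m/n]*n n d ⟩
  n % d + n / d * d        ≤⟨ +-monoˡ-≤ (n / d * d) (<⇒≤ (m%n<n n d)) ⟩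
  d + n / d * d            ≤⟨ +-monoˡ-≤ (n / d * d) d≤[n/d]*d ⟩
  n / d * d + n / d * d    ≡⟨ solve 2 (λ q d → q :* d :+ q :* d := q :* (con 2 :* d)) refl (n / d) d ⟩
  n / d * (2 * d)          ∎
  where
  open ≤-Reasoning
  d≤[n/d]*d : d ≤ n / d * d
  d≤[n/d]*d = ≤-trans (≤-reflexive (sym (*-identityˡ d))) (*-monoˡ-≤ d (m≥n⇒m/n>0 d≤n))

n≡blockedSize : ∀ n d .{{_ : NonZero d}} → n ≡ blockedSize d (n / d) (n % d)
n≡blockedSize n d = begin
  n                           ≡⟨ m≡m%n+[m/n]*n n d ⟩
  n % d + n / d * d           ≡⟨ +-comm (n % d) _ ⟩
  n / d * d + n % d           ≡⟨ cong (_+ n % d) (*-comm (n / d) d) ⟩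
  d * (n / d) + n % d         ≡⟨ blockedSize≡ d (n / d) (n % d) ⟨
  blockedSize d (n / d) (n % d) ∎
  where open ≡-Reasoning

lemma2p2 : (r : ℕ) → 2 ≤ r →
    Σ ℕ (λ C → 1 ≤ C × Σ ℕ (λ N → (n : ℕ) → N ≤ n →
      (2 ^ (n ^ r) ≤ f n r (r + 1) (threeTo r) ^ C)
      × (f n r (r + 1) (threeTo r) ≤ 2 ^ (C * n ^ r))))
lemma2p2 (suc zero) (s≤s ())
lemma2p2 r@(suc (suc _)) _ = C , 1≤C , r , λ n r≤n → lower n r≤n , upper n
  where
  C : ℕ
  C = (2 * r) ^ r
  1≤C : 1 ≤ C
  1≤C = m^n>0 (2 * r) r
  F : ℕ → ℕ
  F n = f n r (r + 1) (threeTo r)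
  lower : ∀ n → r ≤ n → 2 ^ (n ^ r) ≤ F n ^ C
  lower n r≤n = begin
    2 ^ (n ^ r)                 ≤⟨ ^-monoʳ-≤ 2 (^-monoˡ-≤ r (n≤[n/d]*2d n r r≤n)) ⟩
    2 ^ ((n / r * (2 * r)) ^ r) ≡⟨ cong (2 ^_) (^-distribʳ-* (n / r) (2 * r) r) ⟩
    2 ^ ((n / r) ^ r * C)       ≡⟨ ^-*-assoc 2 ((n / r) ^ r) C ⟨
    (2 ^ ((n / r) ^ r)) ^ C     ≤⟨ ^-monoˡ-≤ C (subst (λ k → 2 ^ ((n / r) ^ r) ≤ F k)
                                     (sym (n≡blockedSize n r)) (f-blockedSize≥ r (n / r) (n % r))) ⟩
    F n ^ C                     ∎
    where open ≤-Reasoning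
  upper : ∀ n → F n ≤ 2 ^ (C * n ^ r)
  upper n = ≤-trans (f≤2^n^r n r (r + 1) (threeTo r)) (^-monoʳ-≤ 2 (m≤n*m (n ^ r) C {{>-nonZero 1≤C}}))
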